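{- Let $t,t'$ be finite rooted trees with $t\lhd t'$. Then $|SG(t)|\,m(t;t')=n(t;t')\,|SG(t')|$.
   Context: A rooted tree is a finite partially ordered set (whose elements are called vertices) with a unique greatest element, the root, such that for every vertex $v$ the set of vertices greater than $v$ is a chain. If $v$ covers $w$ in the order, $w$ is a child of $v$; we regard a rooted tree as a directed graph with an edge from each vertex to each of its children, and a vertex is terminal if it has no children. Rooted trees are considered up to isomorphism. $|t|$ denotes the number of vertices of $t$. For rooted trees $t,t'$ write $t\lhd t'$ if $t$ is obtained from $t'$ by deleting one terminal non-root vertex together with the edge into it. For $t\lhd t'$: $n(t;t')$ is the number of vertices of $t$ such that attaching a new edge from that vertex to a new terminal vertex yields (a tree isomorphic to) $t'$; and $m(t;t')$ is the number of edges of $t'$ whose removal (together with their terminal endpoint) leaves (a tree isomorphic to) $t$. For a vertex $v$ of $t$, $t_v$ denotes the rooted tree consisting of $v$ and its descendants. If $v$ has children $v_1,\dots,v_k$, $SG(t,v)$ is the group of permutations of the branches at $v$ generated by the exchanges of $t_{v_i}$ with $t_{v_j}$ whenever these are isomorphic rooted trees; the symmetry group of $t$ is $SG(t)=\prod_{v} SG(t,v)$ (product over all vertices $v$ of $t$), which acts on the vertices of $t$. -}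

module Defs where

open import Data.Nat using (ℕ; zero; suc; _*_)
open import Data.Fin using (Fin; zero; suc)
open import Data.Vec using (Vec; []; _∷_; lookup; map; allFin; removeAt)
open import Data.List using (List; length)
open import Data.List.Membership.Propositional using (_∈_)
open import Data.List.Relation.Unary.Unique.Propositional using (Unique)
open import Data.Fin.Permutation using (Permutation; _⟨$⟩ʳ_)
import Data.Fin.Permutation.Components as PC
open import Data.Bool using (Bool; true; false)
open import Data.Product using (Σ; _×_)
open import Relation.Binary.PropositionalEquality using (_≡_)

-- Finite rooted trees (up to the order of the children, which is irrelevant
-- once we work up to isomorphism): a vertex with k ordered children.
data Tree : Set where
  node : (k : ℕ) → Vec Tree k → Tree

leaf : Tree
leaf = node 0 []

data _≅_ : Tree → Tree → Set where
  iso : ∀ {k l} {ts : Vec Tree k} {us : Vec Tree l}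
        (π : Permutation k l) →
        (∀ i → lookup ts i ≅ lookup us (π ⟨$⟩ʳ i)) →
        node k ts ≅ node l us

-- Vertices of a tree, as paths from the root.
data Pos : Tree → Set where
  root  : ∀ {t} → Pos t
  child : ∀ {k} {ts : Vec Tree k} (i : Fin k) → Pos (lookup ts i) → Pos (node k ts)

data NonRoot : ∀ {t} → Pos t → Set where
  isChild : ∀ {k} {ts : Vec Tree k} {i : Fin k} {p : Pos (lookup ts i)} →
            NonRoot (child {ts = ts} i p)

subtree : (t : Tree) → Pos t → Tree
subtree t root = t
subtree (node k ts) (child i p) = subtree (lookup ts i) p

arity : Tree → ℕ
arity (node k _) = k

Terminal : ∀ {t} → Pos t → Set
Terminal {t} p = arity (subtree t p) ≡ 0

mutual
  graft : (t : Tree) → Pos t → Tree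
  graft (node k ts) root = node (suc k) (leaf ∷ ts)
  graft (node k ts) (child i p) = node k (graftV ts i p)

  graftV : ∀ {k} (ts : Vec Tree k) (i : Fin k) → Pos (lookup ts i) → Vec Tree k
  graftV (t ∷ ts) zero p = graft t p ∷ ts
  graftV (t ∷ ts) (suc i) p = t ∷ graftV ts i p

isRoot : ∀ {t} → Pos t → Bool
isRoot root = true
isRoot (child _ _) = false

-- delete the vertex p together with the edge into it (used only for
-- non-root terminal p; on the root it returns the tree unchanged, and on a
-- non-terminal vertex it removes the whole subtree, cases never used below)
mutual
  delete : (t : Tree) → Pos t → Tree
  delete t root = t
  delete (node (suc k) ts) (child i p) with isRoot p
  ... | true  = node k (removeAt ts i)
  ... | false = node (suc k) (deleteV ts i p)

  deleteV : ∀ {k} (ts : Vec Tree k) (i : Fin k) → Pos (lookup ts i) → Vec Tree k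
  deleteV (t ∷ ts) zero p = delete t p ∷ ts
  deleteV (t ∷ ts) (suc i) p = t ∷ deleteV ts i p

_◁_ : Tree → Tree → Set
t ◁ t' = Σ (Pos t') λ p → NonRoot p × Terminal p × (delete t' p ≅ t)

-- "the number of x : A with P x is n": an explicit duplicate-free list of
-- exactly the elements satisfying P, of length n.
CountIs : (A : Set) → (A → Set) → ℕ → Set
CountIs A P n = Σ (List A) λ l →
  Unique l × length l ≡ n × (∀ x → x ∈ l → P x) × (∀ x → P x → x ∈ l)

NCount : Tree → Tree → ℕ → Set
NCount t t' n = CountIs (Pos t) (λ v → graft t v ≅ t') n

-- m(t;t') = m : number of edges of t' (identified with their non-root
-- target vertex) whose removal together with their terminal endpoint leaves t
MCount : Tree → Tree → ℕ → Set
MCount t t' m =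
  CountIs (Pos t') (λ p → NonRoot p × Terminal p × (delete t' p ≅ t)) m

-- SG(t,v) for a vertex with children ts: the subgroup of the permutations of
-- Fin k (stored as lookup tables) generated by the exchanges of branches i, j
-- with lookup ts i ≅ lookup ts j.
data Gen {k : ℕ} (ts : Vec Tree k) : Vec (Fin k) k → Set where
  gen-id   : Gen ts (allFin k)
  gen-swap : ∀ {σ} → Gen ts σ → (i j : Fin k) → lookup ts i ≅ lookup ts j →
             Gen ts (map (PC.transpose i j) σ)

prodV : ∀ {k} → Vec ℕ k → ℕ
prodV [] = 1
prodV (x ∷ xs) = x * prodV xs

-- SGOrd t n : |SG(t)| = n, where SG(t) = ∏_v SG(t,v), so its order is the
-- product over all vertices v of |SG(t,v)|.
data SGOrd : Tree → ℕ → Set where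
  sg : ∀ {k} {ts : Vec Tree k} {a : ℕ} →
       CountIs (Vec (Fin k) k) (Gen ts) a →
       (ns : Vec ℕ k) →
       (∀ i → SGOrd (lookup ts i) (lookup ns i)) →
       SGOrd (node k ts) (a * prodV ns)

{-# OPTIONS --safe #-}
-- Induction on the depth of the deleted vertex p.  If p is a child of the root of t′, it is
-- a leaf there: n(t;t′) = 1, m(t;t′) is the number c of leaves at the root of t′, and by
-- orbit–stabiliser the branch permutations at the root of t′ number c times those of t.
-- Otherwise p lies in a branch s′ of t′ which becomes d in t.  Comparing multiplicities of
-- isomorphism classes among the branches shows that a graft on t giving t′ must happen in a
-- branch isomorphic to d, and a pruning of t′ giving t in a branch isomorphic to s′; hence
-- n(t;t′) = c_d n(d;s′) and m(t;t′) = c_s′ m(d;s′), where c_x counts the branches isomorphic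
-- to x.  By orbit–stabiliser the branch permutations at the root number c_d S for t and
-- c_s′ S for t′, with the same stabiliser order S, and all other branches are shared, so the
-- identity for (d, s′) gives the one for (t, t′).
module Submission where

open import Defs
open import Level using (0ℓ)
open import Function using (_∘_)
open import Data.Bool using (false)
open import Data.Empty using (⊥-elim)
open import Data.Unit using (⊤; tt)
open import Data.Sum using (_⊎_; inj₁; inj₂)
open import Data.Product using (Σ-syntax; _×_; _,_; proj₁; proj₂; swap)
open import Data.Nat using (ℕ; zero; suc; _+_; _*_; _<_; _≤_; z≤n; s≤s)
import Data.Nat.Properties as ℕ
open import Data.Nat.Tactic.RingSolver using (solve-∀)
open import Data.Fin using (Fin; zero; suc; punchIn; punchOut; toℕ; fromℕ<)
import Data.Fin.Properties as Fin
open import Data.Fin.Permutation as Perm using (Permutation; _⟨$⟩ʳ_; _⟨$⟩ˡ_)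
import Data.Fin.Permutation.Components as PC
open import Data.Vec using (Vec; []; _∷_; lookup; removeAt; insertAt; tabulate; _[_]≔_; allFin)
import Data.Vec as Vec
import Data.Vec.Properties as Vec
open import Data.List using (List; []; _∷_; _++_; length; map; filter)
import Data.List.Properties as List
open import Data.List.Membership.Propositional using (_∈_; _─_)
import Data.List.Membership.Propositional.Properties as ∈
open import Data.List.Relation.Unary.Any using (here; there)
import Data.List.Relation.Unary.All as All
open import Data.List.Relation.Unary.AllPairs using ([]; _∷_)
open import Data.List.Relation.Unary.Unique.Propositional using (Unique)
import Data.List.Relation.Unary.Unique.Propositional.Properties as Unique
open import Relation.Nullary using (¬_; Dec; yes; no)
open import Relation.Nullary.Decidable using (map′; dec-true; dec-false; _×-dec_)
open import Relation.Unary using (Pred; Decidable; _∩_; _≐_)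
open import Relation.Binary.PropositionalEquality
open import Algebra.Properties.Semiring.Sum ℕ.+-*-semiring
  using (sum; sum-cong-≗; sum-remove; sum-permute; sum-replicate-zero; ∑-distrib-+; *-distribʳ-sum)
open import Algebra.Properties.CommutativeMonoid.Sum ℕ.*-1-commutativeMonoid using ()
  renaming (sum to product; sum-remove to product-remove; sum-cong-≗ to product-cong-≗; sum-permute to product-permute)

private variable
  k l n : ℕ

-- Isomorphism of trees

record _≅ᵥ_ (ts : Vec Tree k) (us : Vec Tree l) : Set where
  constructor _,_
  field
    perm  : Permutation k l
    match : ∀ i → lookup ts i ≅ lookup us (perm ⟨$⟩ʳ i)
open _≅ᵥ_

≅⇒≅ᵥ : {ts : Vec Tree k} {us : Vec Tree l} → node k ts ≅ node l us → ts ≅ᵥ us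
≅⇒≅ᵥ (iso π f) = π , f

≅ᵥ⇒≅ : {ts : Vec Tree k} {us : Vec Tree l} → ts ≅ᵥ us → node k ts ≅ node l us
≅ᵥ⇒≅ (π , f) = iso π f

mutual
  ≅-refl : {t : Tree} → t ≅ t
  ≅-refl {node k ts} = iso Perm.id (≅-refl-lookup ts)

  ≅-refl-lookup : (ts : Vec Tree k) (i : Fin k) → lookup ts i ≅ lookup ts i
  ≅-refl-lookup (t ∷ ts) zero    = ≅-refl {t}
  ≅-refl-lookup (t ∷ ts) (suc i) = ≅-refl-lookup ts i

≅-reflexive : {t u : Tree} → t ≡ u → t ≅ u
≅-reflexive refl = ≅-refl

≅-sym : {t u : Tree} → t ≅ u → u ≅ t
≅-sym {node k ts} {node l us} (iso π f) = iso (Perm.flip π) λ j →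
  subst (λ x → lookup us x ≅ lookup ts (π ⟨$⟩ˡ j)) (Perm.inverseʳ π) (≅-sym (f (π ⟨$⟩ˡ j)))

≅-trans : {t u v : Tree} → t ≅ u → u ≅ v → t ≅ v
≅-trans (iso π f) (iso ρ g) = iso (π Perm.∘ₚ ρ) (λ i → ≅-trans (f i) (g (π ⟨$⟩ʳ i)))

≅ᵥ-refl : (ts : Vec Tree k) → ts ≅ᵥ ts
≅ᵥ-refl ts = Perm.id , ≅-refl-lookup ts

≅ᵥ-sym : {ts : Vec Tree k} {us : Vec Tree l} → ts ≅ᵥ us → us ≅ᵥ ts
≅ᵥ-sym {ts = ts} {us} (π , f) = ≅⇒≅ᵥ (≅-sym (iso {ts = ts} {us} π f))

≅ᵥ-trans : {ts : Vec Tree k} {us : Vec Tree l} {vs : Vec Tree n} →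
           ts ≅ᵥ us → us ≅ᵥ vs → ts ≅ᵥ vs
≅ᵥ-trans {ts = ts} {us} {vs} (π , f) (ρ , g) =
  ≅⇒≅ᵥ (≅-trans (iso {ts = ts} {us} π f) (iso {ts = us} {vs} ρ g))

perm-injective : (π : Permutation k l) {x y : Fin k} → π ⟨$⟩ʳ x ≡ π ⟨$⟩ʳ y → x ≡ y
perm-injective π eq = trans (sym (Perm.inverseˡ π)) (trans (cong (π ⟨$⟩ˡ_) eq) (Perm.inverseˡ π))

arity-≅ : {t u : Tree} → t ≅ u → arity t ≡ arity u
arity-≅ (iso π _) = Perm.↔⇒≡ π

data TransposeView {n} (i j : Fin n) : Fin n → Fin n → Set where
  first  : TransposeView i j i j
  second : j ≢ i → TransposeView i j j i
  other  : ∀ {x} → x ≢ i → x ≢ j → TransposeView i j x x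

transposeView : (i j x : Fin n) → TransposeView i j x (PC.transpose i j x)
transposeView i j x with x Fin.≟ i
... | yes refl = first
... | no x≢i with x Fin.≟ j
...   | yes refl = second x≢i
...   | no x≢j   = other x≢i x≢j

transpose-matchˡ : (i j : Fin n) → PC.transpose i j i ≡ j
transpose-matchˡ i j rewrite dec-true (i Fin.≟ i) refl = refl

transpose-matchʳ : (i j : Fin n) → PC.transpose i j j ≡ i
transpose-matchʳ i j with j Fin.≟ i
... | yes refl = refl
... | no j≢i rewrite dec-true (j Fin.≟ j) refl = refl

transpose-other : {i j x : Fin n} → x ≢ i → x ≢ j → PC.transpose i j x ≡ x
transpose-other {i = i} {j} {x} x≢i x≢j
  rewrite dec-false (x Fin.≟ i) x≢i | dec-false (x Fin.≟ j) x≢j = refl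

transpose-involutive : (i j x : Fin n) → PC.transpose i j (PC.transpose i j x) ≡ x
transpose-involutive i j x with PC.transpose i j x | transposeView i j x
... | _ | first         = transpose-matchʳ i j
... | _ | second _      = transpose-matchˡ i j
... | _ | other x≢i x≢j = transpose-other x≢i x≢j

transpose-injective : (i j : Fin n) {x y : Fin n} → PC.transpose i j x ≡ PC.transpose i j y → x ≡ y
transpose-injective i j {x} {y} eq = begin
  x                                        ≡⟨ transpose-involutive i j x ⟨
  PC.transpose i j (PC.transpose i j x)    ≡⟨ cong (PC.transpose i j) eq ⟩
  PC.transpose i j (PC.transpose i j y)    ≡⟨ transpose-involutive i j y ⟩
  y                                        ∎
  where open ≡-Reasoning

swap-≅ : (us : Vec Tree k) (i j : Fin k) → lookup us i ≅ lookup us j →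
         ∀ x → lookup us x ≅ lookup us (PC.transpose i j x)
swap-≅ us i j e x with PC.transpose i j x | transposeView i j x
... | _ | first     = e
... | _ | second _  = ≅-sym e
... | _ | other _ _ = ≅-refl

swap-≅ᵥ : (us : Vec Tree k) (i j : Fin k) → lookup us i ≅ lookup us j → us ≅ᵥ us
swap-≅ᵥ us i j e = Perm.transpose i j , swap-≅ us i j e

lookup-removeAt : {A : Set} (xs : Vec A (suc k)) (i : Fin (suc k)) (j : Fin k) →
                  lookup (removeAt xs i) j ≡ lookup xs (punchIn i j)
lookup-removeAt xs i j = begin
  lookup (removeAt xs i) j
    ≡⟨ Vec.insertAt-punchIn (removeAt xs i) i (lookup xs i) j ⟨
  lookup (insertAt (removeAt xs i) i (lookup xs i)) (punchIn i j)
    ≡⟨ cong (λ ys → lookup ys (punchIn i j)) (Vec.insertAt-removeAt xs i) ⟩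
  lookup xs (punchIn i j)
    ∎
  where open ≡-Reasoning

removeAt-≅ᵥ : {ts : Vec Tree (suc k)} {us : Vec Tree (suc l)} (m : ts ≅ᵥ us)
              {x : Fin (suc k)} {y : Fin (suc l)} → perm m ⟨$⟩ʳ x ≡ y → removeAt ts x ≅ᵥ removeAt us y
removeAt-≅ᵥ {ts = ts} {us} (π , f) {x} refl = Perm.remove x π , λ z →
  subst₂ _≅_ (sym (lookup-removeAt ts x z))
             (trans (cong (lookup us) (Perm.punchIn-permute π x z)) (sym (lookup-removeAt us (π ⟨$⟩ʳ x) _)))
             (f (punchIn x z))

cancel-≅ᵥ : {t : Tree} {ts : Vec Tree k} {us : Vec Tree (suc l)} →
            (t ∷ ts) ≅ᵥ us → (j : Fin (suc l)) → t ≅ lookup us j → ts ≅ᵥ removeAt us j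
cancel-≅ᵥ {us = us} m j e =
  removeAt-≅ᵥ (≅ᵥ-trans m (swap-≅ᵥ us j′ j e′)) {zero} (transpose-matchˡ j′ j)
  where
  j′ = perm m ⟨$⟩ʳ zero
  e′ : lookup us j′ ≅ lookup us j
  e′ = ≅-trans (≅-sym (match m zero)) e

uncancel-≅ᵥ : {t : Tree} {ts : Vec Tree k} {us : Vec Tree (suc l)} →
              (j : Fin (suc l)) → t ≅ lookup us j → ts ≅ᵥ removeAt us j → (t ∷ ts) ≅ᵥ us
uncancel-≅ᵥ {ts = ts} {us} j e (ρ , g) = Perm.insert zero j ρ , λ where
  zero    → e
  (suc i) → subst (lookup ts i ≅_)
                  (trans (lookup-removeAt us j (ρ ⟨$⟩ʳ i)) (cong (lookup us) (sym (Perm.insert-punchIn zero j ρ i))))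
                  (g i)

mutual
  _≅?_ : (t u : Tree) → Dec (t ≅ u)
  node k ts ≅? node l us = map′ ≅ᵥ⇒≅ ≅⇒≅ᵥ (ts ≅ᵥ? us)

  _≅ᵥ?_ : (ts : Vec Tree k) (us : Vec Tree l) → Dec (ts ≅ᵥ us)
  []       ≅ᵥ? []      = yes (Perm.id , λ ())
  []       ≅ᵥ? (_ ∷ _) = no λ (π , _) → Perm.refute (λ ()) π
  (t ∷ ts) ≅ᵥ? []      = no λ (π , _) → Fin.¬Fin0 (π ⟨$⟩ʳ zero)
  (t ∷ ts) ≅ᵥ? us@(_ ∷ _) with Fin.any? (λ j → t ≅? lookup us j)
  ... | no ∄j = no λ m → ∄j (perm m ⟨$⟩ʳ zero , match m zero)
  ... | yes (j , e) with ts ≅ᵥ? removeAt us j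
  ...   | yes m = yes (uncancel-≅ᵥ j e m)
  ...   | no ¬m = no λ m → ¬m (cancel-≅ᵥ m j e)

-- Counting

𝟙 : {A : Set} → Dec A → ℕ
𝟙 (yes _) = 1
𝟙 (no _)  = 0

𝟙-yes : {A : Set} (a? : Dec A) → A → 𝟙 a? ≡ 1
𝟙-yes (yes _) _ = refl
𝟙-yes (no ¬a) a = ⊥-elim (¬a a)

𝟙-no : {A : Set} (a? : Dec A) → ¬ A → 𝟙 a? ≡ 0
𝟙-no (yes a) ¬a = ⊥-elim (¬a a)
𝟙-no (no _)  _  = refl

𝟙-suc : {A : Set} (a? : Dec A) → 𝟙 a? ≡ suc n → A
𝟙-suc (yes a) _ = a

𝟙-cong : {A B : Set} (a? : Dec A) (b? : Dec B) → (A → B) → (B → A) → 𝟙 a? ≡ 𝟙 b?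
𝟙-cong (yes a) b? f g = sym (𝟙-yes b? (f a))
𝟙-cong (no ¬a) b? f g = sym (𝟙-no b? (¬a ∘ g))

sum-𝟙-≟ : (x : Fin k) → sum (λ j → 𝟙 (x Fin.≟ j)) ≡ 1
sum-𝟙-≟ {suc k} x = begin
  sum (λ j → 𝟙 (x Fin.≟ j))                            ≡⟨ sum-remove {i = x} (λ j → 𝟙 (x Fin.≟ j)) ⟩
  𝟙 (x Fin.≟ x) + sum (λ j → 𝟙 (x Fin.≟ punchIn x j))  ≡⟨ cong₂ _+_ (𝟙-yes (x Fin.≟ x) refl) (sum-cong-≗ x≢x↑) ⟩
  1 + sum {k} (λ _ → 0)                                 ≡⟨ cong suc (sum-replicate-zero k) ⟩
  1                                                     ∎
  where
  open ≡-Reasoning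
  x≢x↑ : ∀ j → 𝟙 (x Fin.≟ punchIn x j) ≡ 0
  x≢x↑ j = 𝟙-no (x Fin.≟ punchIn x j) (Fin.punchInᵢ≢i x j ∘ sym)

sum-exchange : (f g : Fin (suc k) → ℕ) (i : Fin (suc k)) → (∀ j → j ≢ i → f j ≡ g j) →
               sum f + g i ≡ sum g + f i
sum-exchange f g i f≡g = begin
  sum f + g i                                ≡⟨ cong (_+ g i) (sum-remove {i = i} f) ⟩
  (f i + sum (λ j → f (punchIn i j))) + g i  ≡⟨ cong (λ s → (f i + s) + g i) (sum-cong-≗ off-i) ⟩
  (f i + sum (λ j → g (punchIn i j))) + g i  ≡⟨ reorder (f i) _ (g i) ⟩
  (g i + sum (λ j → g (punchIn i j))) + f i  ≡⟨ cong (_+ f i) (sum-remove {i = i} g) ⟨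
  sum g + f i                                ∎
  where
  open ≡-Reasoning
  off-i : ∀ j → f (punchIn i j) ≡ g (punchIn i j)
  off-i j = f≡g (punchIn i j) (Fin.punchInᵢ≢i i j)
  reorder : ∀ a s b → (a + s) + b ≡ (b + s) + a
  reorder = solve-∀

module _ {A : Set} where

  private
    ∈-─ : {x y : A} {xs : List A} (x∈ : x ∈ xs) → y ∈ xs → x ≢ y → y ∈ xs ─ x∈
    ∈-─ (here refl) (here refl) x≢y = ⊥-elim (x≢y refl)
    ∈-─ (here _)    (there y∈)  _   = y∈
    ∈-─ (there _)   (here refl) _   = here refl
    ∈-─ (there x∈)  (there y∈)  x≢y = there (∈-─ x∈ y∈ x≢y)

  unique⊆⇒length≤ : {xs ys : List A} → Unique xs → (∀ {x} → x ∈ xs → x ∈ ys) → length xs ≤ length ys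
  unique⊆⇒length≤ [] _ = z≤n
  unique⊆⇒length≤ {x ∷ xs} {ys} (x∉xs ∷ u) xs⊆ys =
    subst (suc (length xs) ≤_) (sym (List.length-removeAt′ ys _))
          (s≤s (unique⊆⇒length≤ u λ y∈ → ∈-─ x∈ys (xs⊆ys (there y∈)) (All.lookup x∉xs y∈)))
    where x∈ys = xs⊆ys (here refl)

  length-filter-∷ : {P : Pred A 0ℓ} (P? : Decidable P) (x : A) (xs : List A) →
                    length (filter P? (x ∷ xs)) ≡ 𝟙 (P? x) + length (filter P? xs)
  length-filter-∷ P? x xs with P? x
  ... | yes _ = refl
  ... | no _  = refl

  length-partition : (g : A → Fin k) (xs : List A) →
                     length xs ≡ sum (λ j → length (filter (λ x → g x Fin.≟ j) xs))
  length-partition {k} g [] = sym (sum-replicate-zero k)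
  length-partition {k} g (x ∷ xs) = begin
    suc (length xs)
      ≡⟨ cong₂ _+_ (sum-𝟙-≟ (g x)) (sym (length-partition g xs)) ⟨
    sum (λ j → 𝟙 (g x Fin.≟ j)) + sum (λ j → length (filter (λ y → g y Fin.≟ j) xs))
      ≡⟨ ∑-distrib-+ (λ j → 𝟙 (g x Fin.≟ j)) _ ⟨
    sum (λ j → 𝟙 (g x Fin.≟ j) + length (filter (λ y → g y Fin.≟ j) xs))
      ≡⟨ sum-cong-≗ (λ j → length-filter-∷ (λ y → g y Fin.≟ j) x xs) ⟨
    sum (λ j → length (filter (λ y → g y Fin.≟ j) (x ∷ xs)))
      ∎
    where open ≡-Reasoning

  CountIs-unique : {P Q : Pred A 0ℓ} {m n : ℕ} → CountIs A P m → CountIs A Q n → P ≐ Q → m ≡ n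
  CountIs-unique (xs , u , refl , sound , complete) (ys , v , refl , sound′ , complete′) (P⊆Q , Q⊆P) =
    ℕ.≤-antisym (unique⊆⇒length≤ u λ {x} x∈ → complete′ x (P⊆Q (sound x x∈)))
                (unique⊆⇒length≤ v λ {x} x∈ → complete x (Q⊆P (sound′ x x∈)))

  CountIs-cong : {P Q : Pred A 0ℓ} → P ≐ Q → CountIs A P n → CountIs A Q n
  CountIs-cong (P⊆Q , Q⊆P) (xs , u , len , sound , complete) =
    xs , u , len , (λ x x∈ → P⊆Q (sound x x∈)) , (λ x qx → complete x (Q⊆P qx))

  CountIs-empty : {P : Pred A 0ℓ} → (∀ x → ¬ P x) → CountIs A P n → n ≡ 0
  CountIs-empty ∄P ([] , _ , len , _)          = sym len
  CountIs-empty ∄P (x ∷ _ , _ , _ , sound , _) = ⊥-elim (∄P x (sound x (here refl)))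

  CountIs-∩ : {P Q : Pred A 0ℓ} → CountIs A P n → Decidable Q → Σ[ m ∈ ℕ ] CountIs A (P ∩ Q) m
  CountIs-∩ (xs , u , _ , sound , complete) Q? =
    length (filter Q? xs) , filter Q? xs , Unique.filter⁺ Q? u , refl ,
    (λ x x∈ → let x∈xs , qx = ∈.∈-filter⁻ Q? x∈ in sound x x∈xs , qx) ,
    (λ x (px , qx) → ∈.∈-filter⁺ Q? (complete x px) qx)

  CountIs-partition : {P : Pred A 0ℓ} → CountIs A P n → (g : A → Fin k) (c : Fin k → ℕ) →
                      (∀ j → CountIs A (P ∩ (λ x → g x ≡ j)) (c j)) → n ≡ sum c
  CountIs-partition C@(xs , _ , refl , _) g c fibre = trans (length-partition g xs) (sum-cong-≗ λ j →
    CountIs-unique (proj₂ (CountIs-∩ C (λ x → g x Fin.≟ j))) (fibre j) ((λ p → p) , (λ p → p)))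

module _ {A B : Set} {P : Pred A 0ℓ} {Q : Pred B 0ℓ}
         (f : A → B) (f-injective : ∀ {x y} → f x ≡ f y → x ≡ y) where

  CountIs-map : (∀ {x} → P x → Q (f x)) → (∀ {y} → Q y → Σ[ x ∈ A ] P x × f x ≡ y) →
                CountIs A P n → CountIs B Q n
  CountIs-map P⇒Q Q⇒P (xs , u , len , sound , complete) =
    map f xs , Unique.map⁺ f-injective u , trans (List.length-map f xs) len , sound′ , complete′
    where
    sound′ : ∀ y → y ∈ map f xs → Q y
    sound′ y y∈ with ∈.∈-map⁻ f y∈
    ... | x , x∈ , refl = P⇒Q (sound x x∈)
    complete′ : ∀ y → Q y → y ∈ map f xs
    complete′ y qy with Q⇒P qy
    ... | x , px , refl = ∈.∈-map⁺ f (complete x px)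

mutual
  count : (t : Tree) {P : Pred (Pos t) 0ℓ} → Decidable P → ℕ
  count (node k ts) P? = 𝟙 (P? root) + countᵥ ts (λ j p → P? (child j p))

  countᵥ : (ts : Vec Tree k) {P : ∀ j → Pred (Pos (lookup ts j)) 0ℓ} → (∀ j → Decidable (P j)) → ℕ
  countᵥ []       _  = 0
  countᵥ (t ∷ ts) P? = count t (P? zero) + countᵥ ts (λ j → P? (suc j))

countᵥ-sum : (ts : Vec Tree k) {P : ∀ j → Pred (Pos (lookup ts j)) 0ℓ} (P? : ∀ j → Decidable (P j)) →
             countᵥ ts P? ≡ sum (λ j → count (lookup ts j) (P? j))
countᵥ-sum []       P? = refl
countᵥ-sum (t ∷ ts) P? = cong (count t (P? zero) +_) (countᵥ-sum ts (λ j → P? (suc j)))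

count-node : (ts : Vec Tree k) {P : Pred (Pos (node k ts)) 0ℓ} (P? : Decidable P) →
             count (node k ts) P? ≡ 𝟙 (P? root) + sum (λ j → count (lookup ts j) (λ p → P? (child j p)))
count-node ts P? = cong (𝟙 (P? root) +_) (countᵥ-sum ts _)

private
  rootIf : {t : Tree} {A : Set} → Dec A → List (Pos t)
  rootIf (yes _) = root ∷ []
  rootIf (no _)  = []

  ∈-rootIf : {t : Tree} {A : Set} (a? : Dec A) {p : Pos t} → p ∈ rootIf a? → p ≡ root × A
  ∈-rootIf (yes a) (here refl) = refl , a

  record Child (ts : Vec Tree k) : Set where
    constructor _,_
    field
      index : Fin k
      pos   : Pos (lookup ts index)

  toPos : {ts : Vec Tree k} → Child ts → Pos (node k ts)
  toPos (j , p) = child j p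

  sucChild : {t : Tree} {ts : Vec Tree k} → Child ts → Child (t ∷ ts)
  sucChild (j , p) = suc j , p

mutual
  vertices : (t : Tree) {P : Pred (Pos t) 0ℓ} → Decidable P → List (Pos t)
  vertices (node k ts) P? = rootIf (P? root) ++ map toPos (verticesᵥ ts (λ j p → P? (child j p)))

  verticesᵥ : (ts : Vec Tree k) {P : ∀ j → Pred (Pos (lookup ts j)) 0ℓ} → (∀ j → Decidable (P j)) →
              List (Child ts)
  verticesᵥ []       _  = []
  verticesᵥ (t ∷ ts) P? = map (zero ,_) (vertices t (P? zero)) ++ map sucChild (verticesᵥ ts (λ j → P? (suc j)))

mutual
  length-vertices : (t : Tree) {P : Pred (Pos t) 0ℓ} (P? : Decidable P) → length (vertices t P?) ≡ count t P?
  length-vertices (node k ts) P? = begin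
    length (rootIf (P? root) ++ map toPos vs)           ≡⟨ List.length-++ (rootIf (P? root)) ⟩
    length (rootIf (P? root)) + length (map toPos vs)   ≡⟨ cong₂ _+_ (length-rootIf (P? root)) (List.length-map toPos vs) ⟩
    𝟙 (P? root) + length vs                             ≡⟨ cong (𝟙 (P? root) +_) (length-verticesᵥ ts _) ⟩
    count (node k ts) P?                                ∎
    where
    open ≡-Reasoning
    vs = verticesᵥ ts (λ j p → P? (child j p))
    length-rootIf : {A : Set} (a? : Dec A) → length (rootIf {node k ts} a?) ≡ 𝟙 a?
    length-rootIf (yes _) = refl
    length-rootIf (no _)  = refl

  length-verticesᵥ : (ts : Vec Tree k) {P : ∀ j → Pred (Pos (lookup ts j)) 0ℓ} (P? : ∀ j → Decidable (P j)) →
                     length (verticesᵥ ts P?) ≡ countᵥ ts P?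
  length-verticesᵥ []       P? = refl
  length-verticesᵥ (t ∷ ts) P? = begin
    length (map f us ++ map sucChild vs)           ≡⟨ List.length-++ (map f us) ⟩
    length (map f us) + length (map sucChild vs)   ≡⟨ cong₂ _+_ (List.length-map f us) (List.length-map sucChild vs) ⟩
    length us + length vs                          ≡⟨ cong₂ _+_ (length-vertices t _) (length-verticesᵥ ts _) ⟩
    countᵥ (t ∷ ts) P?                             ∎
    where
    open ≡-Reasoning
    us = vertices t (P? zero)
    vs = verticesᵥ ts (λ j → P? (suc j))
    f : Pos t → Child (t ∷ ts)
    f = zero ,_

mutual
  vertices-sound : (t : Tree) {P : Pred (Pos t) 0ℓ} (P? : Decidable P) {p : Pos t} →
                   p ∈ vertices t P? → P p
  vertices-sound (node k ts) P? p∈ with ∈.∈-++⁻ (rootIf (P? root)) p∈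
  ... | inj₁ p∈r with ∈-rootIf (P? root) p∈r
  ...   | refl , a = a
  vertices-sound (node k ts) P? p∈ | inj₂ p∈c with ∈.∈-map⁻ toPos p∈c
  ...   | (j , q) , jq∈ , refl = verticesᵥ-sound ts _ jq∈

  verticesᵥ-sound : (ts : Vec Tree k) {P : ∀ j → Pred (Pos (lookup ts j)) 0ℓ} (P? : ∀ j → Decidable (P j))
                    {j : Fin k} {q : Pos (lookup ts j)} → (j , q) ∈ verticesᵥ ts P? → P j q
  verticesᵥ-sound (t ∷ ts) P? jq∈ with ∈.∈-++⁻ (map (zero ,_) (vertices t (P? zero))) jq∈
  ... | inj₁ jq∈₀ with ∈.∈-map⁻ (zero ,_) jq∈₀
  ...   | q , q∈ , refl = vertices-sound t (P? zero) q∈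
  verticesᵥ-sound (t ∷ ts) P? jq∈ | inj₂ jq∈ₛ with ∈.∈-map⁻ sucChild jq∈ₛ
  ...   | (j , q) , jq∈′ , refl = verticesᵥ-sound ts (λ j → P? (suc j)) jq∈′

mutual
  vertices-complete : (t : Tree) {P : Pred (Pos t) 0ℓ} (P? : Decidable P) {p : Pos t} →
                      P p → p ∈ vertices t P?
  vertices-complete (node k ts) P? {root} a with P? root
  ... | yes _ = here refl
  ... | no ¬a = ⊥-elim (¬a a)
  vertices-complete (node k ts) P? {child j q} a =
    ∈.∈-++⁺ʳ (rootIf (P? root)) (∈.∈-map⁺ toPos (verticesᵥ-complete ts _ a))

  verticesᵥ-complete : (ts : Vec Tree k) {P : ∀ j → Pred (Pos (lookup ts j)) 0ℓ} (P? : ∀ j → Decidable (P j))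
                       {j : Fin k} {q : Pos (lookup ts j)} → P j q → (j , q) ∈ verticesᵥ ts P?
  verticesᵥ-complete (t ∷ ts) P? {zero} a =
    ∈.∈-++⁺ˡ (∈.∈-map⁺ (zero ,_) (vertices-complete t (P? zero) a))
  verticesᵥ-complete (t ∷ ts) P? {suc j} a =
    ∈.∈-++⁺ʳ (map (zero ,_) (vertices t (P? zero)))
             (∈.∈-map⁺ sucChild (verticesᵥ-complete ts (λ j → P? (suc j)) a))

mutual
  vertices-unique : (t : Tree) {P : Pred (Pos t) 0ℓ} (P? : Decidable P) → Unique (vertices t P?)
  vertices-unique (node k ts) P? =
    Unique.++⁺ (rootIf-unique (P? root)) (Unique.map⁺ toPos-injective (verticesᵥ-unique ts _)) disjoint
    where
    rootIf-unique : {A : Set} (a? : Dec A) → Unique (rootIf {node k ts} a?)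
    rootIf-unique (yes _) = All.[] ∷ []
    rootIf-unique (no _)  = []
    toPos-injective : {x y : Child ts} → toPos x ≡ toPos y → x ≡ y
    toPos-injective refl = refl
    disjoint : ∀ {p} → ¬ (p ∈ rootIf (P? root) × p ∈ map toPos (verticesᵥ ts _))
    disjoint (p∈r , p∈c) with ∈-rootIf (P? root) p∈r
    ... | refl , _ with ∈.∈-map⁻ toPos p∈c
    ...   | _ , _ , ()

  verticesᵥ-unique : (ts : Vec Tree k) {P : ∀ j → Pred (Pos (lookup ts j)) 0ℓ} (P? : ∀ j → Decidable (P j)) →
                     Unique (verticesᵥ ts P?)
  verticesᵥ-unique []       P? = []
  verticesᵥ-unique (t ∷ ts) P? = Unique.++⁺ (Unique.map⁺ zero-injective (vertices-unique t _))
                                            (Unique.map⁺ suc-injective (verticesᵥ-unique ts _)) disjoint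
    where
    zero-injective : {p q : Pos t} → _≡_ {A = Child (t ∷ ts)} (zero , p) (zero , q) → p ≡ q
    zero-injective refl = refl
    suc-injective : {x y : Child ts} → sucChild {t = t} x ≡ sucChild y → x ≡ y
    suc-injective {_ , _} {_ , _} refl = refl
    disjoint : ∀ {x} → ¬ (x ∈ map (zero ,_) (vertices t (P? zero)) × x ∈ map sucChild (verticesᵥ ts _))
    disjoint (x∈₀ , x∈ₛ) with ∈.∈-map⁻ (zero ,_) x∈₀ | ∈.∈-map⁻ sucChild x∈ₛ
    ... | _ , _ , refl | (_ , _) , _ , ()

count-CountIs : (t : Tree) {P : Pred (Pos t) 0ℓ} (P? : Decidable P) → CountIs (Pos t) P (count t P?)
count-CountIs t P? = vertices t P? , vertices-unique t P? , length-vertices t P? ,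
                     (λ _ → vertices-sound t P?) , (λ _ → vertices-complete t P?)

count-cong : (t : Tree) {P Q : Pred (Pos t) 0ℓ} (P? : Decidable P) (Q? : Decidable Q) →
             P ≐ Q → count t P? ≡ count t Q?
count-cong t P? Q? = CountIs-unique (count-CountIs t P?) (count-CountIs t Q?)

count-empty : (t : Tree) {P : Pred (Pos t) 0ℓ} (P? : Decidable P) → (∀ p → ¬ P p) → count t P? ≡ 0
count-empty t P? ∄P = CountIs-empty ∄P (count-CountIs t P?)

count-onlyRoot : (t : Tree) {P : Pred (Pos t) 0ℓ} (P? : Decidable P) → (∀ p → NonRoot p → ¬ P p) →
                 count t P? ≡ 𝟙 (P? root)
count-onlyRoot (node k ts) P? ∄P = begin
  count (node k ts) P?                                                   ≡⟨ count-node ts P? ⟩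
  𝟙 (P? root) + sum (λ j → count (lookup ts j) (λ p → P? (child j p)))   ≡⟨ cong (𝟙 (P? root) +_) (sum-cong-≗ none) ⟩
  𝟙 (P? root) + sum {k} (λ _ → 0)                                        ≡⟨ cong (𝟙 (P? root) +_) (sum-replicate-zero k) ⟩
  𝟙 (P? root) + 0                                                        ≡⟨ ℕ.+-identityʳ _ ⟩
  𝟙 (P? root)                                                            ∎
  where
  open ≡-Reasoning
  none : ∀ j → count (lookup ts j) (λ p → P? (child j p)) ≡ 0
  none j = count-empty _ _ (λ p → ∄P (child j p) isChild)

count-children : (ts : Vec Tree k) {P : Pred (Pos (node k ts)) 0ℓ} (P? : Decidable P) → ¬ P root →
                 count (node k ts) P? ≡ sum (λ j → count (lookup ts j) (λ p → P? (child j p)))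
count-children {k} ts P? ¬P-root = trans (count-node ts P?) (cong (_+ rest) (𝟙-no (P? root) ¬P-root))
  where rest = sum {k} (λ j → count (lookup ts j) (λ p → P? (child j p)))

pos≅ : {t u : Tree} → t ≅ u → Pos t → Pos u
pos≅ _         root        = root
pos≅ (iso π f) (child i p) = child (π ⟨$⟩ʳ i) (pos≅ (f i) p)

count-≅ : {t u : Tree} (e : t ≅ u) {P : Pred (Pos t) 0ℓ} {Q : Pred (Pos u) 0ℓ}
          (P? : Decidable P) (Q? : Decidable Q) →
          (∀ p → P p → Q (pos≅ e p)) → (∀ p → Q (pos≅ e p) → P p) → count t P? ≡ count u Q?
count-≅ {node k ts} {node l us} (iso π f) P? Q? P⇒Q Q⇒P = begin
  count (node k ts) P?
    ≡⟨ count-node ts P? ⟩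
  𝟙 (P? root) + sum (λ j → count (lookup ts j) (λ p → P? (child j p)))
    ≡⟨ cong₂ _+_ (𝟙-cong (P? root) (Q? root) (P⇒Q root) (Q⇒P root)) (sum-cong-≗ λ j →
                 count-≅ (f j) _ _ (λ p → P⇒Q (child j p)) (λ p → Q⇒P (child j p))) ⟩
  𝟙 (Q? root) + sum (λ j → count (lookup us (π ⟨$⟩ʳ j)) (λ p → Q? (child (π ⟨$⟩ʳ j) p)))
    ≡⟨ cong (𝟙 (Q? root) +_) (sum-permute (λ y → count (lookup us y) (λ p → Q? (child y p))) π) ⟨
  𝟙 (Q? root) + sum (λ y → count (lookup us y) (λ p → Q? (child y p)))
    ≡⟨ count-node us Q? ⟨
  count (node l us) Q?
    ∎
  where open ≡-Reasoning

-- Grafting and deleting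

graftV-update : (ts : Vec Tree k) (i : Fin k) (p : Pos (lookup ts i)) →
                graftV ts i p ≡ ts [ i ]≔ graft (lookup ts i) p
graftV-update (t ∷ ts) zero    p = refl
graftV-update (t ∷ ts) (suc i) p = cong (t ∷_) (graftV-update ts i p)

deleteV-update : (ts : Vec Tree k) (i : Fin k) (p : Pos (lookup ts i)) →
                 deleteV ts i p ≡ ts [ i ]≔ delete (lookup ts i) p
deleteV-update (t ∷ ts) zero    p = refl
deleteV-update (t ∷ ts) (suc i) p = cong (t ∷_) (deleteV-update ts i p)

root-or-nonRoot : {t : Tree} (p : Pos t) → p ≡ root ⊎ NonRoot p
root-or-nonRoot root        = inj₁ refl
root-or-nonRoot (child _ _) = inj₂ isChild

nonRoot⇒isRoot≡false : {t : Tree} {p : Pos t} → NonRoot p → isRoot p ≡ false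
nonRoot⇒isRoot≡false isChild = refl

delete-child : (ts : Vec Tree (suc k)) (i : Fin (suc k)) {q : Pos (lookup ts i)} → NonRoot q →
               delete (node (suc k) ts) (child i q) ≡ node (suc k) (ts [ i ]≔ delete (lookup ts i) q)
delete-child ts i {q} nr with isRoot q | nonRoot⇒isRoot≡false nr
... | false | refl = cong (node _) (deleteV-update ts i q)

update-≅ᵥ : {ts : Vec Tree k} {us : Vec Tree l} (m : ts ≅ᵥ us) (i : Fin k) {j : Fin l} →
            perm m ⟨$⟩ʳ i ≡ j → {a b : Tree} → a ≅ b → (ts [ i ]≔ a) ≅ᵥ (us [ j ]≔ b)
update-≅ᵥ {ts = ts} {us} (π , f) i refl {a} {b} a≅b = π , pointwise
  where
  pointwise : ∀ x → lookup (ts [ i ]≔ a) x ≅ lookup (us [ π ⟨$⟩ʳ i ]≔ b) (π ⟨$⟩ʳ x)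
  pointwise x with x Fin.≟ i
  ... | yes refl rewrite Vec.lookup∘update x ts a | Vec.lookup∘update (π ⟨$⟩ʳ x) us b = a≅b
  ... | no x≢i rewrite Vec.lookup∘update′ x≢i ts a
                     | Vec.lookup∘update′ (x≢i ∘ perm-injective π) us b = f x

nonRoot-≅ : {t u : Tree} (e : t ≅ u) {p : Pos t} → NonRoot p → NonRoot (pos≅ e p)
nonRoot-≅ (iso π f) isChild = isChild

nonRoot-≅⁻ : {t u : Tree} (e : t ≅ u) (p : Pos t) → NonRoot (pos≅ e p) → NonRoot p
nonRoot-≅⁻ e root        ()
nonRoot-≅⁻ e (child _ _) _ = isChild

subtree-≅ : {t u : Tree} (e : t ≅ u) (p : Pos t) → subtree t p ≅ subtree u (pos≅ e p)
subtree-≅ e         root        = e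
subtree-≅ (iso π f) (child i p) = subtree-≅ (f i) p

terminal-≅ : {t u : Tree} (e : t ≅ u) (p : Pos t) → Terminal p → Terminal (pos≅ e p)
terminal-≅ e p = trans (sym (arity-≅ (subtree-≅ e p)))

terminal-≅⁻ : {t u : Tree} (e : t ≅ u) (p : Pos t) → Terminal (pos≅ e p) → Terminal p
terminal-≅⁻ e p = trans (arity-≅ (subtree-≅ e p))

graft-≅ : {t u : Tree} (e : t ≅ u) (v : Pos t) → graft t v ≅ graft u (pos≅ e v)
graft-≅ (iso π f) root = iso (Perm.lift₀ π) λ where
  zero    → ≅-refl
  (suc i) → f i
graft-≅ {node k ts} {node l us} e@(iso π f) (child i p)
  rewrite graftV-update ts i p | graftV-update us (π ⟨$⟩ʳ i) (pos≅ (f i) p) =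
  ≅ᵥ⇒≅ (update-≅ᵥ (≅⇒≅ᵥ e) i refl (graft-≅ (f i) p))

delete-≅ : {t u : Tree} (e : t ≅ u) (p : Pos t) → NonRoot p → delete t p ≅ delete u (pos≅ e p)
delete-≅ {node (suc k) ts} {node zero us} (iso π f) (child i q) _ = ⊥-elim (Fin.¬Fin0 (π ⟨$⟩ʳ i))
delete-≅ {node (suc k) ts} {node (suc l) us} e@(iso π f) (child i q) _ with root-or-nonRoot q
... | inj₁ refl = ≅ᵥ⇒≅ (removeAt-≅ᵥ (≅⇒≅ᵥ e) refl)
... | inj₂ nr   = subst₂ _≅_ (sym (delete-child ts i nr)) (sym (delete-child us (π ⟨$⟩ʳ i) (nonRoot-≅ (f i) nr)))
                             (≅ᵥ⇒≅ (update-≅ᵥ (≅⇒≅ᵥ e) i refl (delete-≅ (f i) q nr)))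

Pruning : (t t′ : Tree) → Pred (Pos t′) 0ℓ
Pruning t t′ p = NonRoot p × Terminal p × (delete t′ p ≅ t)

nonRoot? : {t : Tree} → Decidable (NonRoot {t})
nonRoot? root        = no λ ()
nonRoot? (child _ _) = yes isChild

pruning? : (t t′ : Tree) → Decidable (Pruning t t′)
pruning? t t′ p = nonRoot? p ×-dec arity (subtree t′ p) ℕ.≟ 0 ×-dec delete t′ p ≅? t

#grafts : Tree → Tree → ℕ
#grafts t t′ = count t (λ v → graft t v ≅? t′)

#prunings : Tree → Tree → ℕ
#prunings t t′ = count t′ (pruning? t t′)

#grafts-resp-≅ˡ : {t u : Tree} (t′ : Tree) → t ≅ u → #grafts t t′ ≡ #grafts u t′
#grafts-resp-≅ˡ t′ e =
  count-≅ e _ _ (λ v g → ≅-trans (≅-sym (graft-≅ e v)) g) (λ v g → ≅-trans (graft-≅ e v) g)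

#prunings-resp-≅ˡ : {t u : Tree} (t′ : Tree) → t ≅ u → #prunings t t′ ≡ #prunings u t′
#prunings-resp-≅ˡ t′ e = count-cong t′ _ _
  ((λ (nr , tm , d) → nr , tm , ≅-trans d e) , (λ (nr , tm , d) → nr , tm , ≅-trans d (≅-sym e)))

#prunings-resp-≅ʳ : (t : Tree) {t′ u′ : Tree} → t′ ≅ u′ → #prunings t t′ ≡ #prunings t u′
#prunings-resp-≅ʳ t e = count-≅ e _ _
  (λ p (nr , tm , d) → nonRoot-≅ e nr , terminal-≅ e p tm , ≅-trans (≅-sym (delete-≅ e p nr)) d)
  (λ p (nr , tm , d) → let nr′ = nonRoot-≅⁻ e p nr in
                       nr′ , terminal-≅⁻ e p tm , ≅-trans (delete-≅ e p nr′) d)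

size : Tree → ℕ
size t = count t {λ _ → ⊤} (λ _ → yes tt)

size-node : (ts : Vec Tree k) → size (node k ts) ≡ suc (sum (λ j → size (lookup ts j)))
size-node ts = count-node ts (λ _ → yes tt)

size-≅ : {t u : Tree} → t ≅ u → size t ≡ size u
size-≅ e = count-≅ e _ _ _ _

size-delete : (t : Tree) (p : Pos t) → NonRoot p → size (delete t p) < size t
size-delete (node (suc k) ts) (child i q) _ with root-or-nonRoot q
... | inj₁ refl = begin-strict
  size (node k (removeAt ts i))
    ≡⟨ size-node (removeAt ts i) ⟩
  suc (sum (λ j → size (lookup (removeAt ts i) j)))
    ≡⟨ cong suc (sum-cong-≗ λ j → cong size (lookup-removeAt ts i j)) ⟩
  suc (sum (λ j → size (lookup ts (punchIn i j))))
    <⟨ s≤s (ℕ.m<n+m _ (size-pos (lookup ts i))) ⟩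
  suc (size (lookup ts i) + sum (λ j → size (lookup ts (punchIn i j))))
    ≡⟨ cong suc (sum-remove {i = i} (size ∘ lookup ts)) ⟨
  suc (sum (λ j → size (lookup ts j)))
    ≡⟨ size-node ts ⟨
  size (node (suc k) ts)
    ∎
  where
  open ℕ.≤-Reasoning
  size-pos : ∀ t → 0 < size t
  size-pos (node _ _) = s≤s z≤n
... | inj₂ nr = begin-strict
  size (delete (node (suc k) ts) (child i q))  ≡⟨ cong size (delete-child ts i nr) ⟩
  size (node (suc k) ts′)                      ≡⟨ size-node ts′ ⟩
  suc (sum f)                                  <⟨ s≤s (ℕ.+-cancelʳ-< (g i) (sum f) (sum g) Σf+gᵢ<Σg+gᵢ) ⟩
  suc (sum g)                                  ≡⟨ size-node ts ⟨
  size (node (suc k) ts)                       ∎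
  where
  open ℕ.≤-Reasoning
  ts′ = ts [ i ]≔ delete (lookup ts i) q
  f g : Fin (suc k) → ℕ
  f j = size (lookup ts′ j)
  g j = size (lookup ts j)
  fᵢ<gᵢ : f i < g i
  fᵢ<gᵢ = subst (_< g i) (cong size (sym (Vec.lookup∘update i ts _))) (size-delete (lookup ts i) q nr)
  Σf+gᵢ<Σg+gᵢ : sum f + g i < sum g + g i
  Σf+gᵢ<Σg+gᵢ = begin-strict
    sum f + g i  ≡⟨ sum-exchange f g i (λ j j≢i → cong size (Vec.lookup∘update′ j≢i ts _)) ⟩
    sum g + f i  <⟨ ℕ.+-monoʳ-< (sum g) fᵢ<gᵢ ⟩
    sum g + g i  ∎

delete-≇ : (t : Tree) (p : Pos t) → NonRoot p → ¬ (delete t p ≅ t)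
delete-≇ t p nr e = ℕ.<-irrefl (size-≅ e) (size-delete t p nr)

-- Branch multiplicities

multiplicity : Vec Tree k → Tree → ℕ
multiplicity ts x = sum (λ j → 𝟙 (lookup ts j ≅? x))

multiplicity-≅ᵥ : {ts : Vec Tree k} {us : Vec Tree l} → ts ≅ᵥ us → ∀ x → multiplicity ts x ≡ multiplicity us x
multiplicity-≅ᵥ {ts = ts} {us} (π , f) x = begin
  sum (λ j → 𝟙 (lookup ts j ≅? x))           ≡⟨ sum-cong-≗ (λ j → 𝟙-cong _ _ (≅-trans (≅-sym (f j))) (≅-trans (f j))) ⟩
  sum (λ j → 𝟙 (lookup us (π ⟨$⟩ʳ j) ≅? x))  ≡⟨ sum-permute (λ y → 𝟙 (lookup us y ≅? x)) π ⟨
  sum (λ y → 𝟙 (lookup us y ≅? x))           ∎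
  where open ≡-Reasoning

multiplicity-update : (ts : Vec Tree (suc k)) (i : Fin (suc k)) (y x : Tree) →
                      multiplicity (ts [ i ]≔ y) x + 𝟙 (lookup ts i ≅? x) ≡ multiplicity ts x + 𝟙 (y ≅? x)
multiplicity-update ts i y x = begin
  multiplicity (ts [ i ]≔ y) x + 𝟙 (lookup ts i ≅? x)
    ≡⟨ sum-exchange _ _ i (λ j j≢i → cong (λ z → 𝟙 (z ≅? x)) (Vec.lookup∘update′ j≢i ts y)) ⟩
  multiplicity ts x + 𝟙 (lookup (ts [ i ]≔ y) i ≅? x)
    ≡⟨ cong (λ z → multiplicity ts x + 𝟙 (z ≅? x)) (Vec.lookup∘update i ts y) ⟩
  multiplicity ts x + 𝟙 (y ≅? x)
    ∎
  where open ≡-Reasoning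

-- Comparing multiplicities: that of y forces g ≅ y, and then that of the i-th branch x
-- forces the j-th branch to be a copy of x.
exchange : (ts : Vec Tree (suc k)) (i j : Fin (suc k)) {g y : Tree} → ¬ (lookup ts i ≅ y) →
           node (suc k) (ts [ j ]≔ g) ≅ node (suc k) (ts [ i ]≔ y) → lookup ts j ≅ lookup ts i × g ≅ y
exchange ts i j {g} {y} x≇y e = 𝟙-suc (lookup ts j ≅? x) 𝟙[tsⱼ≅x]≡1 , g≅y
  where
  open ≡-Reasoning
  x = lookup ts i
  M  = multiplicity ts
  M₁ = multiplicity (ts [ j ]≔ g)
  M₂ = multiplicity (ts [ i ]≔ y)

  M₁≡M₂ : ∀ z → M₁ z ≡ M₂ z
  M₁≡M₂ = multiplicity-≅ᵥ (≅⇒≅ᵥ e)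

  M₂y : M₂ y ≡ M y + 1
  M₂y = begin
    M₂ y               ≡⟨ ℕ.+-identityʳ _ ⟨
    M₂ y + 0           ≡⟨ cong (M₂ y +_) (𝟙-no (x ≅? y) x≇y) ⟨
    M₂ y + 𝟙 (x ≅? y)  ≡⟨ multiplicity-update ts i y y ⟩
    M y + 𝟙 (y ≅? y)   ≡⟨ cong (M y +_) (𝟙-yes (y ≅? y) ≅-refl) ⟩
    M y + 1            ∎

  g≅y : g ≅ y
  g≅y = 𝟙-suc (g ≅? y) (ℕ.+-cancelˡ-≡ (M y) _ _ (begin
    M y + 𝟙 (g ≅? y)                  ≡⟨ multiplicity-update ts j g y ⟨
    M₁ y + 𝟙 (lookup ts j ≅? y)       ≡⟨ cong (_+ 𝟙 (lookup ts j ≅? y)) (trans (M₁≡M₂ y) M₂y) ⟩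
    (M y + 1) + 𝟙 (lookup ts j ≅? y)  ≡⟨ ℕ.+-assoc (M y) 1 _ ⟩
    M y + suc (𝟙 (lookup ts j ≅? y))  ∎))

  M₂x : M₂ x + 1 ≡ M x
  M₂x = begin
    M₂ x + 1           ≡⟨ cong (M₂ x +_) (𝟙-yes (x ≅? x) ≅-refl) ⟨
    M₂ x + 𝟙 (x ≅? x)  ≡⟨ multiplicity-update ts i y x ⟩
    M x + 𝟙 (y ≅? x)   ≡⟨ cong (M x +_) (𝟙-no (y ≅? x) (x≇y ∘ ≅-sym)) ⟩
    M x + 0            ≡⟨ ℕ.+-identityʳ _ ⟩
    M x                ∎

  𝟙[tsⱼ≅x]≡1 : 𝟙 (lookup ts j ≅? x) ≡ 1
  𝟙[tsⱼ≅x]≡1 = sym (ℕ.+-cancelˡ-≡ (M₂ x) _ _ (begin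
    M₂ x + 1                     ≡⟨ M₂x ⟩
    M x                          ≡⟨ ℕ.+-identityʳ _ ⟨
    M x + 0                      ≡⟨ cong (M x +_) (𝟙-no (g ≅? x) λ g≅x → x≇y (≅-trans (≅-sym g≅x) g≅y)) ⟨
    M x + 𝟙 (g ≅? x)             ≡⟨ multiplicity-update ts j g x ⟨
    M₁ x + 𝟙 (lookup ts j ≅? x)  ≡⟨ cong (_+ 𝟙 (lookup ts j ≅? x)) (M₁≡M₂ x) ⟩
    M₂ x + 𝟙 (lookup ts j ≅? x)  ∎))

exchange⁻ : (ts : Vec Tree (suc k)) (i j : Fin (suc k)) {g y : Tree} →
            lookup ts j ≅ lookup ts i → g ≅ y → node (suc k) (ts [ j ]≔ g) ≅ node (suc k) (ts [ i ]≔ y)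
exchange⁻ ts i j tsⱼ≅tsᵢ g≅y =
  ≅ᵥ⇒≅ (update-≅ᵥ (swap-≅ᵥ ts j i tsⱼ≅tsᵢ) j (transpose-matchˡ j i) g≅y)

-- Branch symmetries

Table : ℕ → Set
Table k = Vec (Fin k) k

lookup-extensional : {A : Set} {xs ys : Vec A n} → (∀ i → lookup xs i ≡ lookup ys i) → xs ≡ ys
lookup-extensional {xs = xs} {ys} eq = begin
  xs                    ≡⟨ Vec.tabulate∘lookup xs ⟨
  tabulate (lookup xs)  ≡⟨ Vec.tabulate-cong eq ⟩
  tabulate (lookup ys)  ≡⟨ Vec.tabulate∘lookup ys ⟩
  ys                    ∎
  where open ≡-Reasoning

map-transpose-involutive : (i j : Fin k) (σ : Table k) →
                           Vec.map (PC.transpose i j) (Vec.map (PC.transpose i j) σ) ≡ σ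
map-transpose-involutive i j σ =
  trans (sym (Vec.map-∘ _ _ σ)) (trans (Vec.map-cong (transpose-involutive i j) σ) (Vec.map-id σ))

record IsSymmetry (ts : Vec Tree k) (σ : Table k) : Set where
  field
    injective : ∀ {x y} → lookup σ x ≡ lookup σ y → x ≡ y
    preserves : ∀ x → lookup ts (lookup σ x) ≅ lookup ts x
open IsSymmetry

symmetry-transpose : {ts : Vec Tree k} {σ : Table k} (i j : Fin k) → lookup ts i ≅ lookup ts j →
                     IsSymmetry ts σ → IsSymmetry ts (Vec.map (PC.transpose i j) σ)
symmetry-transpose {ts = ts} {σ} i j e s = record
  { injective = λ {x} {y} eq → injective s (transpose-injective i j
      (trans (sym (Vec.lookup-map x τ σ)) (trans eq (Vec.lookup-map y τ σ))))
  ; preserves = λ x → subst (λ z → lookup ts z ≅ lookup ts x) (sym (Vec.lookup-map x τ σ))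
      (≅-trans (≅-sym (swap-≅ ts i j e (lookup σ x))) (preserves s x))
  }
  where τ = PC.transpose i j

Gen⇒IsSymmetry : {ts : Vec Tree k} {σ : Table k} → Gen ts σ → IsSymmetry ts σ
Gen⇒IsSymmetry {ts = ts} gen-id = record
  { injective = λ {x} {y} eq → trans (sym (Vec.lookup-allFin x)) (trans eq (Vec.lookup-allFin y))
  ; preserves = λ x → ≅-reflexive (cong (lookup ts) (Vec.lookup-allFin x))
  }
Gen⇒IsSymmetry (gen-swap g i j e) = symmetry-transpose i j e (Gen⇒IsSymmetry g)

FixesBelow : ℕ → Table k → Set
FixesBelow m σ = ∀ x → toℕ x < m → lookup σ x ≡ x

-- Composing with the transposition of m and σ(m) fixes m as well; repeat until σ is the identity.
fixing-symmetry⇒Gen : {ts : Vec Tree k} (r m : ℕ) → m + r ≡ k → {σ : Table k} →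
                      IsSymmetry ts σ → FixesBelow m σ → Gen ts σ
fixing-symmetry⇒Gen {k} {ts} zero m m+0≡k {σ} _ fixed = subst (Gen ts) σ-id gen-id
  where
  m≡k : m ≡ k
  m≡k = trans (sym (ℕ.+-identityʳ m)) m+0≡k
  σ-id : allFin k ≡ σ
  σ-id = lookup-extensional λ x →
    trans (Vec.lookup-allFin x) (sym (fixed x (subst (toℕ x <_) (sym m≡k) (Fin.toℕ<n x))))
fixing-symmetry⇒Gen {k} {ts} (suc r) m m+1+r≡k {σ} s fixed =
  subst (Gen ts) (map-transpose-involutive x₀ y σ) (gen-swap (fixing-symmetry⇒Gen r (suc m)
    (trans (sym (ℕ.+-suc m r)) m+1+r≡k) (symmetry-transpose x₀ y e s) fixed′) x₀ y e)
  where
  m<k : m < k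
  m<k = subst (m <_) m+1+r≡k (ℕ.m<m+n m (s≤s z≤n))
  x₀ = fromℕ< m<k
  y  = lookup σ x₀
  τ  = PC.transpose x₀ y
  e : lookup ts x₀ ≅ lookup ts y
  e = ≅-sym (preserves s x₀)
  fixed′ : FixesBelow (suc m) (Vec.map τ σ)
  fixed′ x x<1+m rewrite Vec.lookup-map x τ σ with ℕ.m≤n⇒m<n∨m≡n (ℕ.≤-pred x<1+m)
  ... | inj₁ x<m = trans (cong τ (fixed x x<m)) (transpose-other x≢x₀ x≢y)
    where
    x≢x₀ : x ≢ x₀
    x≢x₀ refl = ℕ.<-irrefl (Fin.toℕ-fromℕ< m<k) x<m
    x≢y : x ≢ y
    x≢y x≡y = x≢x₀ (injective s (trans (fixed x x<m) x≡y))
  ... | inj₂ x≡m with Fin.toℕ-injective (trans x≡m (sym (Fin.toℕ-fromℕ< m<k)))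
  ...   | refl = transpose-matchʳ x₀ y

IsSymmetry⇒Gen : {ts : Vec Tree k} {σ : Table k} → IsSymmetry ts σ → Gen ts σ
IsSymmetry⇒Gen {k} s = fixing-symmetry⇒Gen k 0 refl s (λ _ ())

Stabiliser : Vec Tree k → Fin k → Pred (Table k) 0ℓ
Stabiliser ts i σ = Gen ts σ × lookup σ i ≡ i

-- The σ with σ(i) = j form a coset of the stabiliser of i if branch j is a copy of branch i,
-- and there are none otherwise.
orbit-stabiliser : {ts : Vec Tree k} (i : Fin k) {a s : ℕ} → CountIs (Table k) (Gen ts) a →
                   CountIs (Table k) (Stabiliser ts i) s → a ≡ multiplicity ts (lookup ts i) * s
orbit-stabiliser {k} {ts} i {a} {s} G S = begin
  a                                               ≡⟨ CountIs-partition G (λ σ → lookup σ i) c (proj₂ ∘ fibre) ⟩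
  sum c                                           ≡⟨ sum-cong-≗ c≡ ⟩
  sum (λ j → 𝟙 (lookup ts j ≅? lookup ts i) * s)  ≡⟨ *-distribʳ-sum s (λ j → 𝟙 (lookup ts j ≅? lookup ts i)) ⟨
  multiplicity ts (lookup ts i) * s               ∎
  where
  open ≡-Reasoning
  Fibre : Fin k → Pred (Table k) 0ℓ
  Fibre j = Gen ts ∩ (λ σ → lookup σ i ≡ j)
  fibre : ∀ j → Σ[ n ∈ ℕ ] CountIs (Table k) (Fibre j) n
  fibre j = CountIs-∩ G (λ σ → lookup σ i Fin.≟ j)
  c : Fin k → ℕ
  c j = proj₁ (fibre j)

  coset : ∀ j → lookup ts i ≅ lookup ts j → CountIs (Table k) (Fibre j) s
  coset j e = CountIs-map τ* τ*-injective
    (λ {σ} (g , σᵢ≡i) → gen-swap g i j e , τ*-at σ σᵢ≡i (transpose-matchˡ i j))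
    (λ {ρ} (g , ρᵢ≡j) → τ* ρ , (gen-swap g i j e , τ*-at ρ ρᵢ≡j (transpose-matchʳ i j)) , map-transpose-involutive i j ρ)
    S
    where
    τ = PC.transpose i j
    τ* = Vec.map τ
    τ*-at : ∀ σ {x y} → lookup σ i ≡ x → τ x ≡ y → lookup (τ* σ) i ≡ y
    τ*-at σ σᵢ≡x τx≡y = trans (Vec.lookup-map i τ σ) (trans (cong τ σᵢ≡x) τx≡y)
    τ*-injective : ∀ {σ ρ} → τ* σ ≡ τ* ρ → σ ≡ ρ
    τ*-injective {σ} {ρ} eq =
      trans (sym (map-transpose-involutive i j σ)) (trans (cong τ* eq) (map-transpose-involutive i j ρ))

  c≡ : ∀ j → c j ≡ 𝟙 (lookup ts j ≅? lookup ts i) * s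
  c≡ j with lookup ts j ≅? lookup ts i
  ... | yes e = trans (CountIs-unique (proj₂ (fibre j)) (coset j (≅-sym e)) ((λ p → p) , (λ p → p)))
                      (sym (ℕ.*-identityˡ s))
  ... | no ¬e = CountIs-empty (λ σ (g , σᵢ≡j) → ¬e (subst (λ z → lookup ts z ≅ lookup ts i) σᵢ≡j
                                                       (preserves (Gen⇒IsSymmetry g) i)))
                              (proj₂ (fibre j))

symmetry-update : {ts : Vec Tree k} {σ : Table k} (i : Fin k) (y : Tree) →
                  IsSymmetry ts σ → lookup σ i ≡ i → IsSymmetry (ts [ i ]≔ y) σ
symmetry-update {ts = ts} {σ} i y s σᵢ≡i = record { injective = injective s ; preserves = preserves′ }
  where
  preserves′ : ∀ x → lookup (ts [ i ]≔ y) (lookup σ x) ≅ lookup (ts [ i ]≔ y) x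
  preserves′ x with x Fin.≟ i
  ... | yes refl = ≅-reflexive (cong (lookup (ts [ x ]≔ y)) σᵢ≡i)
  ... | no x≢i rewrite Vec.lookup∘update′ (λ σₓ≡i → x≢i (injective s (trans σₓ≡i (sym σᵢ≡i)))) ts y
                     | Vec.lookup∘update′ x≢i ts y = preserves s x

stabiliser-update : (ts : Vec Tree k) (i : Fin k) (y : Tree) → Stabiliser ts i ≐ Stabiliser (ts [ i ]≔ y) i
stabiliser-update ts i y =
  stabilises ts y , λ {σ} st → subst (λ us → Stabiliser us i σ) restore (stabilises (ts [ i ]≔ y) (lookup ts i) st)
  where
  stabilises : (us : Vec Tree _) (z : Tree) {σ : Table _} → Stabiliser us i σ → Stabiliser (us [ i ]≔ z) i σ
  stabilises us z (g , σᵢ≡i) = IsSymmetry⇒Gen (symmetry-update i z (Gen⇒IsSymmetry g) σᵢ≡i) , σᵢ≡i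
  restore : (ts [ i ]≔ y) [ i ]≔ lookup ts i ≡ ts
  restore = trans (Vec.[]≔-idempotent ts i) (Vec.[]≔-lookup ts i)

data PunchView (i : Fin (suc k)) : Fin (suc k) → Set where
  at        : PunchView i i
  punchedIn : (y : Fin k) → PunchView i (punchIn i y)

punchView : (i x : Fin (suc k)) → PunchView i x
punchView i x with i Fin.≟ x
... | yes refl = at
... | no i≢x   = subst (PunchView i) (Fin.punchIn-punchOut i≢x) (punchedIn (punchOut i≢x))

module _ (ts : Vec Tree (suc k)) (i : Fin (suc k)) where

  private
    extend : Table k → Table (suc k)
    extend ρ = insertAt (Vec.map (punchIn i) ρ) i i

    extend-at : ∀ ρ → lookup (extend ρ) i ≡ i
    extend-at ρ = Vec.insertAt-lookup (Vec.map (punchIn i) ρ) i i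

    extend-punchIn : ∀ ρ y → lookup (extend ρ) (punchIn i y) ≡ punchIn i (lookup ρ y)
    extend-punchIn ρ y =
      trans (Vec.insertAt-punchIn (Vec.map (punchIn i) ρ) i i y) (Vec.lookup-map y (punchIn i) ρ)

    extend-injective : ∀ {ρ ρ′} → extend ρ ≡ extend ρ′ → ρ ≡ ρ′
    extend-injective {ρ} {ρ′} eq = lookup-extensional λ y → Fin.punchIn-injective i _ _
      (trans (sym (extend-punchIn ρ y)) (trans (cong (λ σ → lookup σ (punchIn i y)) eq) (extend-punchIn ρ′ y)))

    extend-symmetry : ∀ {ρ} → IsSymmetry (removeAt ts i) ρ → IsSymmetry ts (extend ρ)
    extend-symmetry {ρ} s = record { injective = inj ; preserves = pres }
      where
      inj : ∀ {x y} → lookup (extend ρ) x ≡ lookup (extend ρ) y → x ≡ y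
      inj {x} {y} eq with punchView i x | punchView i y
      ... | at           | at           = refl
      ... | at           | punchedIn y′ =
        ⊥-elim (Fin.punchInᵢ≢i i _ (trans (sym (extend-punchIn ρ y′)) (trans (sym eq) (extend-at ρ))))
      ... | punchedIn x′ | at           =
        ⊥-elim (Fin.punchInᵢ≢i i _ (trans (sym (extend-punchIn ρ x′)) (trans eq (extend-at ρ))))
      ... | punchedIn x′ | punchedIn y′ = cong (punchIn i) (injective s (Fin.punchIn-injective i _ _
        (trans (sym (extend-punchIn ρ x′)) (trans eq (extend-punchIn ρ y′)))))
      pres : ∀ x → lookup ts (lookup (extend ρ) x) ≅ lookup ts x
      pres x with punchView i x
      ... | at          rewrite extend-at ρ = ≅-refl
      ... | punchedIn y rewrite extend-punchIn ρ y =
        subst₂ _≅_ (lookup-removeAt ts i (lookup ρ y)) (lookup-removeAt ts i y) (preserves s y)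

    restrict : ∀ {σ} → IsSymmetry ts σ → lookup σ i ≡ i →
               Σ[ ρ ∈ Table k ] IsSymmetry (removeAt ts i) ρ × extend ρ ≡ σ
    restrict {σ} s σᵢ≡i = ρ , record { injective = inj ; preserves = pres } , lookup-extensional extend-ρ
      where
      i≢σ[i↑y] : ∀ y → i ≢ lookup σ (punchIn i y)
      i≢σ[i↑y] y eq = Fin.punchInᵢ≢i i y (injective s (trans (sym eq) (sym σᵢ≡i)))
      ρ : Table k
      ρ = tabulate λ y → punchOut (i≢σ[i↑y] y)
      ρ-punchIn : ∀ y → punchIn i (lookup ρ y) ≡ lookup σ (punchIn i y)
      ρ-punchIn y = trans (cong (punchIn i) (Vec.lookup∘tabulate _ y)) (Fin.punchIn-punchOut (i≢σ[i↑y] y))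
      inj : ∀ {x y} → lookup ρ x ≡ lookup ρ y → x ≡ y
      inj {x} {y} eq = Fin.punchIn-injective i x y (injective s
        (trans (sym (ρ-punchIn x)) (trans (cong (punchIn i) eq) (ρ-punchIn y))))
      pres : ∀ y → lookup (removeAt ts i) (lookup ρ y) ≅ lookup (removeAt ts i) y
      pres y rewrite lookup-removeAt ts i (lookup ρ y) | lookup-removeAt ts i y | ρ-punchIn y =
        preserves s (punchIn i y)
      extend-ρ : ∀ x → lookup (extend ρ) x ≡ lookup σ x
      extend-ρ x with punchView i x
      ... | at          = trans (extend-at ρ) (sym σᵢ≡i)
      ... | punchedIn y = trans (extend-punchIn ρ y) (ρ-punchIn y)

  stabiliser-removeAt : {a : ℕ} → CountIs (Table k) (Gen (removeAt ts i)) a →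
                        CountIs (Table (suc k)) (Stabiliser ts i) a
  stabiliser-removeAt = CountIs-map extend extend-injective
    (λ {ρ} g → IsSymmetry⇒Gen (extend-symmetry (Gen⇒IsSymmetry g)) , extend-at ρ)
    (λ (g , σᵢ≡i) → let ρ , s , eq = restrict (Gen⇒IsSymmetry g) σᵢ≡i in ρ , IsSymmetry⇒Gen s , eq)

conjugate : Permutation k l → Table k → Table l
conjugate π σ = tabulate λ y → π ⟨$⟩ʳ lookup σ (π ⟨$⟩ˡ y)

lookup-conjugate : (π : Permutation k l) (σ : Table k) (y : Fin l) →
                   lookup (conjugate π σ) y ≡ π ⟨$⟩ʳ lookup σ (π ⟨$⟩ˡ y)
lookup-conjugate π σ = Vec.lookup∘tabulate _

conjugate-symmetry : {ts : Vec Tree k} {us : Vec Tree l} (m : ts ≅ᵥ us) {σ : Table k} →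
                     IsSymmetry ts σ → IsSymmetry us (conjugate (perm m) σ)
conjugate-symmetry {ts = ts} {us} (π , f) {σ} s = record { injective = inj ; preserves = pres }
  where
  inj : ∀ {x y} → lookup (conjugate π σ) x ≡ lookup (conjugate π σ) y → x ≡ y
  inj {x} {y} eq = perm-injective (Perm.flip π) (injective s (perm-injective π
    (trans (sym (lookup-conjugate π σ x)) (trans eq (lookup-conjugate π σ y)))))
  pres : ∀ y → lookup us (lookup (conjugate π σ) y) ≅ lookup us y
  pres y rewrite lookup-conjugate π σ y =
    ≅-trans (≅-sym (f (lookup σ x)))
            (≅-trans (preserves s x) (subst (λ z → lookup ts x ≅ lookup us z) (Perm.inverseʳ π) (f x)))
    where x = π ⟨$⟩ˡ y

conjugate-inverse : (π : Permutation k l) (ρ : Table l) → conjugate π (conjugate (Perm.flip π) ρ) ≡ ρ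
conjugate-inverse π ρ = lookup-extensional λ y → begin
  lookup (conjugate π (conjugate (Perm.flip π) ρ)) y  ≡⟨ lookup-conjugate π (conjugate (Perm.flip π) ρ) y ⟩
  π ⟨$⟩ʳ lookup (conjugate (Perm.flip π) ρ) (π ⟨$⟩ˡ y) ≡⟨ cong (π ⟨$⟩ʳ_) (lookup-conjugate (Perm.flip π) ρ _) ⟩
  π ⟨$⟩ʳ (π ⟨$⟩ˡ lookup ρ (π ⟨$⟩ʳ (π ⟨$⟩ˡ y)))        ≡⟨ Perm.inverseʳ π ⟩
  lookup ρ (π ⟨$⟩ʳ (π ⟨$⟩ˡ y))                         ≡⟨ cong (lookup ρ) (Perm.inverseʳ π) ⟩
  lookup ρ y                                           ∎
  where open ≡-Reasoning

conjugate-injective : (π : Permutation k l) {σ σ′ : Table k} → conjugate π σ ≡ conjugate π σ′ → σ ≡ σ′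
conjugate-injective π {σ} {σ′} eq = begin
  σ                                         ≡⟨ conjugate-inverse (Perm.flip π) σ ⟨
  conjugate (Perm.flip π) (conjugate π σ)   ≡⟨ cong (conjugate (Perm.flip π)) eq ⟩
  conjugate (Perm.flip π) (conjugate π σ′)  ≡⟨ conjugate-inverse (Perm.flip π) σ′ ⟩
  σ′                                        ∎
  where open ≡-Reasoning

Gen-count-≅ᵥ : {ts : Vec Tree k} {us : Vec Tree l} → ts ≅ᵥ us → {a : ℕ} →
               CountIs (Table k) (Gen ts) a → CountIs (Table l) (Gen us) a
Gen-count-≅ᵥ m = CountIs-map (conjugate (perm m)) (conjugate-injective (perm m))
  (λ g → IsSymmetry⇒Gen (conjugate-symmetry m (Gen⇒IsSymmetry g)))
  (λ {ρ} g → conjugate (perm (≅ᵥ-sym m)) ρ ,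
             IsSymmetry⇒Gen (conjugate-symmetry (≅ᵥ-sym m) (Gen⇒IsSymmetry g)) ,
             conjugate-inverse (perm m) ρ)

-- Orders of symmetry groups

prodV-product : (ns : Vec ℕ k) → prodV ns ≡ product (lookup ns)
prodV-product []       = refl
prodV-product (n ∷ ns) = cong (n *_) (prodV-product ns)

prodV-removeAt : (ns : Vec ℕ (suc k)) (i : Fin (suc k)) → prodV ns ≡ lookup ns i * prodV (removeAt ns i)
prodV-removeAt ns i = begin
  prodV ns                                               ≡⟨ prodV-product ns ⟩
  product (lookup ns)                                    ≡⟨ product-remove {i = i} (lookup ns) ⟩
  lookup ns i * product (λ j → lookup ns (punchIn i j))  ≡⟨ cong (lookup ns i *_) removed ⟨
  lookup ns i * prodV (removeAt ns i)                    ∎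
  where
  open ≡-Reasoning
  removed : prodV (removeAt ns i) ≡ product (λ j → lookup ns (punchIn i j))
  removed = trans (prodV-product (removeAt ns i)) (product-cong-≗ (lookup-removeAt ns i))

prodV-cong : (ns ms : Vec ℕ k) → (∀ i → lookup ns i ≡ lookup ms i) → prodV ns ≡ prodV ms
prodV-cong ns ms eq = cong prodV (lookup-extensional {xs = ns} {ms} eq)

SGOrd-unique : {t : Tree} {a b : ℕ} → SGOrd t a → SGOrd t b → a ≡ b
SGOrd-unique (sg G ns orders) (sg G′ ns′ orders′) = cong₂ _*_
  (CountIs-unique G G′ ((λ g → g) , (λ g → g)))
  (prodV-cong ns ns′ λ i → SGOrd-unique (orders i) (orders′ i))

SGOrd-leaf : {a : ℕ} → SGOrd leaf a → a ≡ 1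
SGOrd-leaf (sg {a = a} G [] _) = trans (ℕ.*-identityʳ a) (CountIs-unique G G₁ ((λ g → g) , (λ g → g)))
  where
  G₁ : CountIs (Table 0) (Gen []) 1
  G₁ = [] ∷ [] , All.[] ∷ [] , refl , (λ { _ (here refl) → gen-id }) , (λ { [] _ → here refl })

SGOrd-≅ : {t u : Tree} {a : ℕ} → t ≅ u → SGOrd t a → SGOrd u a
SGOrd-≅ {node k ts} {node l us} e@(iso π f) (sg {a = a} G ns orders) =
  subst (SGOrd (node l us)) (cong (a *_) prodV-ns′) (sg (Gen-count-≅ᵥ (≅⇒≅ᵥ e) G) ns′ orders′)
  where
  ns′ : Vec ℕ l
  ns′ = tabulate λ y → lookup ns (π ⟨$⟩ˡ y)
  orders′ : ∀ y → SGOrd (lookup us y) (lookup ns′ y)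
  orders′ y = subst (SGOrd (lookup us y)) (sym (Vec.lookup∘tabulate _ y)) (SGOrd-≅
    (subst (λ z → lookup ts (π ⟨$⟩ˡ y) ≅ lookup us z) (Perm.inverseʳ π) (f (π ⟨$⟩ˡ y)))
    (orders (π ⟨$⟩ˡ y)))
  prodV-ns′ : prodV ns′ ≡ prodV ns
  prodV-ns′ = begin
    prodV ns′                             ≡⟨ prodV-product ns′ ⟩
    product (lookup ns′)                  ≡⟨ product-cong-≗ (Vec.lookup∘tabulate (lookup ns ∘ (π ⟨$⟩ˡ_))) ⟩
    product (λ y → lookup ns (π ⟨$⟩ˡ y))  ≡⟨ product-permute (lookup ns) (Perm.flip π) ⟨
    product (lookup ns)                   ≡⟨ prodV-product ns ⟨
    prodV ns                              ∎
    where open ≡-Reasoning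

-- Deleting a terminal child of the root

arity≡0⇒leaf : (t : Tree) → arity t ≡ 0 → t ≡ leaf
arity≡0⇒leaf (node zero []) _ = refl

module _ (ts′ : Vec Tree (suc k)) (i : Fin (suc k)) (terminal : arity (lookup ts′ i) ≡ 0) where

  private
    t t′ : Tree
    t  = node k (removeAt ts′ i)
    t′ = node (suc k) ts′

  #grafts-leafChild : #grafts t t′ ≡ 1
  #grafts-leafChild = begin
    #grafts t t′            ≡⟨ count-onlyRoot t (λ v → graft t v ≅? t′) deeper ⟩
    𝟙 (graft t root ≅? t′)  ≡⟨ 𝟙-yes (graft t root ≅? t′) (≅ᵥ⇒≅ (uncancel-≅ᵥ i leaf≅tsᵢ (≅ᵥ-refl _))) ⟩
    1                       ∎
    where
    open ≡-Reasoning
    deeper : ∀ v → NonRoot v → ¬ (graft t v ≅ t′)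
    deeper (child _ _) _ e = ℕ.1+n≢n (sym (arity-≅ e))
    leaf≅tsᵢ : leaf ≅ lookup ts′ i
    leaf≅tsᵢ = ≅-reflexive (sym (arity≡0⇒leaf _ terminal))

  #prunings-leafChild : #prunings t t′ ≡ multiplicity ts′ (lookup ts′ i)
  #prunings-leafChild = trans (count-children ts′ (pruning? t t′) λ ()) (sum-cong-≗ prunings-in)
    where
    prunes⇒copy : ∀ j → Pruning t t′ (child j root) → lookup ts′ j ≅ lookup ts′ i
    prunes⇒copy j (_ , terminalⱼ , _) =
      ≅-reflexive (trans (arity≡0⇒leaf _ terminalⱼ) (sym (arity≡0⇒leaf _ terminal)))
    copy⇒prunes : ∀ j → lookup ts′ j ≅ lookup ts′ i → Pruning t t′ (child j root)
    copy⇒prunes j e = isChild , trans (arity-≅ e) terminal ,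
                      ≅ᵥ⇒≅ (removeAt-≅ᵥ (swap-≅ᵥ ts′ j i e) (transpose-matchˡ j i))
    deeper : ∀ j p → NonRoot p → ¬ Pruning t t′ (child j p)
    deeper j p nr (_ , _ , e) = ℕ.1+n≢n (trans (sym (cong arity (delete-child ts′ j nr))) (arity-≅ e))
    prunings-in : ∀ j → count (lookup ts′ j) (λ p → pruning? t t′ (child j p)) ≡
                        𝟙 (lookup ts′ j ≅? lookup ts′ i)
    prunings-in j = trans (count-onlyRoot (lookup ts′ j) _ (deeper j))
                          (𝟙-cong _ _ (prunes⇒copy j) (copy⇒prunes j))

  SGOrd-leafChild : {a a′ : ℕ} → SGOrd t a → SGOrd t′ a′ → a′ ≡ multiplicity ts′ (lookup ts′ i) * a
  SGOrd-leafChild (sg {a = a} G ns orders) (sg {a = a′} G′ ns′ orders′) = begin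
    a′ * prodV ns′
      ≡⟨ cong₂ _*_ (orbit-stabiliser i G′ (stabiliser-removeAt ts′ i G)) (prodV-removeAt ns′ i) ⟩
    (c * a) * (lookup ns′ i * prodV (removeAt ns′ i))
      ≡⟨ cong₂ (λ x y → (c * a) * (x * y)) ns′ᵢ≡1 (sym prodV-ns≡) ⟩
    (c * a) * (1 * prodV ns)
      ≡⟨ rearrange c a (prodV ns) ⟩
    c * (a * prodV ns)
      ∎
    where
    open ≡-Reasoning
    c = multiplicity ts′ (lookup ts′ i)
    ns′ᵢ≡1 : lookup ns′ i ≡ 1
    ns′ᵢ≡1 = SGOrd-leaf (subst (λ u → SGOrd u (lookup ns′ i)) (arity≡0⇒leaf _ terminal) (orders′ i))
    prodV-ns≡ : prodV ns ≡ prodV (removeAt ns′ i)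
    prodV-ns≡ = prodV-cong ns (removeAt ns′ i) λ y → SGOrd-unique (orders y)
      (subst₂ SGOrd (sym (lookup-removeAt ts′ i y)) (sym (lookup-removeAt ns′ i y)) (orders′ (punchIn i y)))
    rearrange : ∀ c a p → (c * a) * (1 * p) ≡ c * (a * p)
    rearrange = solve-∀

-- Deleting a deeper vertex

module _ (ts′ : Vec Tree (suc k)) (i : Fin (suc k)) {q : Pos (lookup ts′ i)} (nr : NonRoot q) where

  private
    s′ d : Tree
    s′ = lookup ts′ i
    d  = delete s′ q
    ts : Vec Tree (suc k)
    ts = ts′ [ i ]≔ d
    t t′ : Tree
    t  = node (suc k) ts
    t′ = node (suc k) ts′

    d≇s′ : ¬ (d ≅ s′)
    d≇s′ = delete-≇ s′ q nr

    tsᵢ≡d : lookup ts i ≡ d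
    tsᵢ≡d = Vec.lookup∘update i ts′ d

    t′≡ : node (suc k) (ts [ i ]≔ s′) ≡ t′
    t′≡ = cong (node (suc k)) (trans (Vec.[]≔-idempotent ts′ i) (Vec.[]≔-lookup ts′ i))

    graft-child : ∀ j w → graft t (child j w) ≡ node (suc k) (ts [ j ]≔ graft (lookup ts j) w)
    graft-child j w = cong (node (suc k)) (graftV-update ts j w)

    grafting⇒ : ∀ j w → graft t (child j w) ≅ t′ → lookup ts j ≅ d × graft (lookup ts j) w ≅ s′
    grafting⇒ j w e =
      let tsⱼ≅tsᵢ , g≅s′ = exchange ts i j {g = graft (lookup ts j) w} {y = s′}
                             (d≇s′ ∘ subst (_≅ s′) tsᵢ≡d) (subst₂ _≅_ (graft-child j w) (sym t′≡) e)
      in ≅-trans tsⱼ≅tsᵢ (≅-reflexive tsᵢ≡d) , g≅s′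

    grafting⇐ : ∀ j w → lookup ts j ≅ d → graft (lookup ts j) w ≅ s′ → graft t (child j w) ≅ t′
    grafting⇐ j w tsⱼ≅d g≅s′ = subst₂ _≅_ (sym (graft-child j w)) t′≡
      (exchange⁻ ts i j (≅-trans tsⱼ≅d (≅-reflexive (sym tsᵢ≡d))) g≅s′)

    pruning⇒ : ∀ j p → Pruning t t′ (child j p) → lookup ts′ j ≅ s′ × Pruning d (lookup ts′ j) p
    pruning⇒ j p (_ , terminalₚ , e) with root-or-nonRoot p
    ... | inj₁ refl = ⊥-elim (ℕ.1+n≢n (sym (arity-≅ e)))
    ... | inj₂ nrₚ =
      let tsⱼ≅s′ , e′ = exchange ts′ i j (d≇s′ ∘ ≅-sym) (subst (_≅ t) (delete-child ts′ j nrₚ) e)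
      in tsⱼ≅s′ , nrₚ , terminalₚ , e′

    pruning⇐ : ∀ j p → lookup ts′ j ≅ s′ → Pruning d (lookup ts′ j) p → Pruning t t′ (child j p)
    pruning⇐ j p tsⱼ≅s′ (nrₚ , terminalₚ , e′) =
      isChild , terminalₚ , subst (_≅ t) (sym (delete-child ts′ j nrₚ)) (exchange⁻ ts′ i j tsⱼ≅s′ e′)

  #grafts-deep : #grafts t t′ ≡ multiplicity ts d * #grafts d s′
  #grafts-deep = begin
    #grafts t t′
      ≡⟨ count-children ts (λ v → graft t v ≅? t′) (λ e → ℕ.1+n≢n (arity-≅ e)) ⟩
    sum (λ j → count (lookup ts j) (λ w → graft t (child j w) ≅? t′))
      ≡⟨ sum-cong-≗ grafts-in ⟩
    sum (λ j → 𝟙 (lookup ts j ≅? d) * #grafts d s′)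
      ≡⟨ *-distribʳ-sum (#grafts d s′) (λ j → 𝟙 (lookup ts j ≅? d)) ⟨
    multiplicity ts d * #grafts d s′
      ∎
    where
    open ≡-Reasoning
    grafts-in : ∀ j → count (lookup ts j) (λ w → graft t (child j w) ≅? t′) ≡
                      𝟙 (lookup ts j ≅? d) * #grafts d s′
    grafts-in j with lookup ts j ≅? d
    ... | no tsⱼ≇d  = count-empty (lookup ts j) _ (λ w → tsⱼ≇d ∘ proj₁ ∘ grafting⇒ j w)
    ... | yes tsⱼ≅d = begin
      count (lookup ts j) (λ w → graft t (child j w) ≅? t′)
        ≡⟨ count-cong (lookup ts j) _ _ ((λ {w} → proj₂ ∘ grafting⇒ j w) , λ {w} → grafting⇐ j w tsⱼ≅d) ⟩
      #grafts (lookup ts j) s′  ≡⟨ #grafts-resp-≅ˡ s′ tsⱼ≅d ⟩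
      #grafts d s′              ≡⟨ ℕ.*-identityˡ _ ⟨
      1 * #grafts d s′          ∎

  #prunings-deep : #prunings t t′ ≡ multiplicity ts′ s′ * #prunings d s′
  #prunings-deep = begin
    #prunings t t′
      ≡⟨ count-children ts′ (pruning? t t′) (λ ()) ⟩
    sum (λ j → count (lookup ts′ j) (λ p → pruning? t t′ (child j p)))
      ≡⟨ sum-cong-≗ prunings-in ⟩
    sum (λ j → 𝟙 (lookup ts′ j ≅? s′) * #prunings d s′)
      ≡⟨ *-distribʳ-sum (#prunings d s′) (λ j → 𝟙 (lookup ts′ j ≅? s′)) ⟨
    multiplicity ts′ s′ * #prunings d s′
      ∎
    where
    open ≡-Reasoning
    prunings-in : ∀ j → count (lookup ts′ j) (λ p → pruning? t t′ (child j p)) ≡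
                        𝟙 (lookup ts′ j ≅? s′) * #prunings d s′
    prunings-in j with lookup ts′ j ≅? s′
    ... | no tsⱼ≇s′  = count-empty (lookup ts′ j) _ (λ p → tsⱼ≇s′ ∘ proj₁ ∘ pruning⇒ j p)
    ... | yes tsⱼ≅s′ = begin
      count (lookup ts′ j) (λ p → pruning? t t′ (child j p))
        ≡⟨ count-cong (lookup ts′ j) _ _ ((λ {p} → proj₂ ∘ pruning⇒ j p) , λ {p} → pruning⇐ j p tsⱼ≅s′) ⟩
      #prunings d (lookup ts′ j)  ≡⟨ #prunings-resp-≅ʳ d tsⱼ≅s′ ⟩
      #prunings d s′              ≡⟨ ℕ.*-identityˡ _ ⟨
      1 * #prunings d s′          ∎

  -- Branch i has the same stabiliser in ts and ts′, and the other branches are shared.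
  SGOrd-deep-step : (∀ {b b′} → SGOrd d b → SGOrd s′ b′ → b * #prunings d s′ ≡ #grafts d s′ * b′) →
                    ∀ {a a′} → SGOrd t a → SGOrd t′ a′ → a * #prunings t t′ ≡ #grafts t t′ * a′
  SGOrd-deep-step step (sg {a = A} G ns orders) (sg {a = A′} G′ ns′ orders′) = begin
    (A * prodV ns) * #prunings t t′      ≡⟨ cong₂ (λ x y → (x * y) * #prunings t t′) A≡ (prodV-removeAt ns i) ⟩
    (cd * S) * (b * R) * #prunings t t′  ≡⟨ cong ((cd * S) * (b * R) *_) #prunings-deep ⟩
    (cd * S) * (b * R) * (cs * M)        ≡⟨ regroup cd S b R cs M ⟩
    (cd * S * R * cs) * (b * M)          ≡⟨ cong (cd * S * R * cs *_) (step bᵢ b′ᵢ) ⟩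
    (cd * S * R * cs) * (N * b′)         ≡⟨ regroup′ cd S R cs N b′ ⟩
    (cd * N) * ((cs * S) * (b′ * R))     ≡⟨ cong₂ _*_ (sym #grafts-deep) (cong₂ _*_ (sym A′≡) (sym prodV-ns′)) ⟩
    #grafts t t′ * (A′ * prodV ns′)      ∎
    where
    open ≡-Reasoning
    cd = multiplicity ts d
    cs = multiplicity ts′ s′
    M  = #prunings d s′
    N  = #grafts d s′
    b  = lookup ns i
    b′ = lookup ns′ i
    R  = prodV (removeAt ns i)
    bᵢ : SGOrd d b
    bᵢ = subst (λ u → SGOrd u b) tsᵢ≡d (orders i)
    b′ᵢ : SGOrd s′ b′
    b′ᵢ = orders′ i
    stabiliser = CountIs-∩ G (λ σ → lookup σ i Fin.≟ i)
    S = proj₁ stabiliser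
    A≡ : A ≡ cd * S
    A≡ = trans (orbit-stabiliser i G (proj₂ stabiliser)) (cong (λ x → multiplicity ts x * S) tsᵢ≡d)
    A′≡ : A′ ≡ cs * S
    A′≡ = orbit-stabiliser i G′ (CountIs-cong (swap (stabiliser-update ts′ i d)) (proj₂ stabiliser))
    others : ∀ y → lookup (removeAt ns′ i) y ≡ lookup (removeAt ns i) y
    others y = SGOrd-unique
      (subst₂ SGOrd (sym (lookup-removeAt ts′ i y)) (sym (lookup-removeAt ns′ i y)) (orders′ (punchIn i y)))
      (subst₂ SGOrd (trans (Vec.lookup∘update′ (Fin.punchInᵢ≢i i y) ts′ d) (sym (lookup-removeAt ts′ i y)))
                    (sym (lookup-removeAt ns i y)) (orders (punchIn i y)))
    prodV-ns′ : prodV ns′ ≡ b′ * R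
    prodV-ns′ = trans (prodV-removeAt ns′ i) (cong (b′ *_) (prodV-cong (removeAt ns′ i) (removeAt ns i) others))
    regroup : ∀ cd S b R cs M → (cd * S) * (b * R) * (cs * M) ≡ (cd * S * R * cs) * (b * M)
    regroup = solve-∀
    regroup′ : ∀ cd S R cs N b′ → (cd * S * R * cs) * (N * b′) ≡ (cd * N) * ((cs * S) * (b′ * R))
    regroup′ = solve-∀

SGOrd-#prunings-#grafts : (t′ : Tree) (p : Pos t′) → NonRoot p → Terminal p → {a a′ : ℕ} →
                          SGOrd (delete t′ p) a → SGOrd t′ a′ →
                          a * #prunings (delete t′ p) t′ ≡ #grafts (delete t′ p) t′ * a′
SGOrd-#prunings-#grafts (node zero _) (child () _)
SGOrd-#prunings-#grafts t′@(node (suc k) ts′) (child i q) _ terminal {a} {a′} SG SG′ with root-or-nonRoot q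
... | inj₁ refl = begin
  a * #prunings t t′  ≡⟨ cong (a *_) (#prunings-leafChild ts′ i terminal) ⟩
  a * c               ≡⟨ ℕ.*-comm a c ⟩
  c * a               ≡⟨ SGOrd-leafChild ts′ i terminal SG SG′ ⟨
  a′                  ≡⟨ ℕ.*-identityˡ a′ ⟨
  1 * a′              ≡⟨ cong (_* a′) (#grafts-leafChild ts′ i terminal) ⟨
  #grafts t t′ * a′   ∎
  where
  open ≡-Reasoning
  t = node k (removeAt ts′ i)
  c = multiplicity ts′ (lookup ts′ i)
... | inj₂ nr = subst (λ u → a * #prunings u t′ ≡ #grafts u t′ * a′) (sym (delete-child ts′ i nr))
  (SGOrd-deep-step ts′ i nr (SGOrd-#prunings-#grafts (lookup ts′ i) q nr terminal)
                   (subst (λ u → SGOrd u a) (delete-child ts′ i nr) SG) SG′)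

proposition2p1 : (t t' : Tree) → t ◁ t' →
    (sgt sgt' n m : ℕ) → SGOrd t sgt → SGOrd t' sgt' →
    NCount t t' n → MCount t t' m →
    sgt * m ≡ n * sgt'
proposition2p1 t t′ (p , nr , terminal , deleted≅t) sgt sgt′ n m SG SG′ N M = begin
  sgt * m                           ≡⟨ cong (sgt *_) m≡ ⟩
  sgt * #prunings (delete t′ p) t′  ≡⟨ SGOrd-#prunings-#grafts t′ p nr terminal (SGOrd-≅ t≅deleted SG) SG′ ⟩
  #grafts (delete t′ p) t′ * sgt′   ≡⟨ cong (_* sgt′) n≡ ⟨
  n * sgt′                          ∎
  where
  open ≡-Reasoning
  t≅deleted : t ≅ delete t′ p
  t≅deleted = ≅-sym deleted≅t
  m≡ : m ≡ #prunings (delete t′ p) t′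
  m≡ = trans (CountIs-unique M (count-CountIs t′ (pruning? t t′)) ((λ x → x) , (λ x → x)))
             (#prunings-resp-≅ˡ t′ t≅deleted)
  n≡ : n ≡ #grafts (delete t′ p) t′
  n≡ = trans (CountIs-unique N (count-CountIs t (λ v → graft t v ≅? t′)) ((λ x → x) , (λ x → x)))
             (#grafts-resp-≅ˡ t′ t≅deleted)
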